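{- If two $2$-level $d$-configurations $(A,B)$ and $(A',B')$ have the same slack matrix up to permutation of rows and columns, then $(A,B)$ and $(A',B')$ are linearly equivalent.
   Context: A \emph{$2$-level $d$-configuration} is a pair $(A,B)$ of sets $A,B\subseteq\mathbb{R}^d$, each linearly spanning $\mathbb{R}^d$, with $\langle a,b\rangle\in\{0,1\}$ for all $a\in A$, $b\in B$, and maximal with respect to this property: $A=\{a\in\mathbb{R}^d:\langle a,b\rangle\in\{0,1\}\ \forall b\in B\}$ and $B=\{b\in\mathbb{R}^d:\langle a,b\rangle\in\{0,1\}\ \forall a\in A\}$. Its \emph{slack matrix} $S(A,B)$ has rows indexed by $A$, columns indexed by $B$, and entries $S_{ab}=\langle a,b\rangle$. Two configurations $(A,B)$, $(A',B')$ are \emph{linearly equivalent} if there is a non-singular $M\in\mathbb{R}^{d\times d}$ with $A'=\{M^{ -\top}a:a\in A\}$ and $B'=\{Mb:b\in B\}$. -}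

module Defs where

open import Level using (Level; _⊔_) renaming (suc to lsuc)
open import Data.Nat using (ℕ; zero; suc)
open import Data.Fin using (Fin; zero; suc; _≟_)
open import Relation.Nullary using (yes; no)
open import Data.Product using (Σ; ∃; ∃-syntax; _×_; _,_; proj₁)
open import Data.Sum using (_⊎_)
open import Relation.Nullary using (¬_)
open import Relation.Unary using (Pred)
open import Relation.Binary using (Setoid; IsEquivalence)
open import Function.Bundles using (_⇔_; Bijection; module Bijection)
open import Algebra.Bundles using (CommutativeRing)

record Field (c ℓ : Level) : Set (lsuc (c ⊔ ℓ)) where
  field
    commutativeRing : CommutativeRing c ℓ
  open CommutativeRing commutativeRing public
  field
    0≉1      : ¬ (0# ≈ 1#)
    inverse  : ∀ x → ¬ (x ≈ 0#) → ∃[ y ] (x * y ≈ 1#)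

module LinearAlgebra {c ℓ : Level} (K : Field c ℓ) where
  open Field K using (Carrier; _≈_; _+_; _*_; 0#; 1#; refl; sym; trans)

  Vecᵈ : ℕ → Set c
  Vecᵈ d = Fin d → Carrier

  Mat : ℕ → Set c
  Mat d = Fin d → Fin d → Carrier

  ∑ : ∀ {n} → (Fin n → Carrier) → Carrier
  ∑ {zero}  f = 0#
  ∑ {suc n} f = f zero + ∑ (λ i → f (suc i))

  _≈ᵛ_ : ∀ {d} → Vecᵈ d → Vecᵈ d → Set ℓ
  u ≈ᵛ v = ∀ i → u i ≈ v i

  _≈ᵐ_ : ∀ {d} → Mat d → Mat d → Set ℓ
  M ≈ᵐ N = ∀ i j → M i j ≈ N i j

  ⟨_,_⟩ : ∀ {d} → Vecᵈ d → Vecᵈ d → Carrier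
  ⟨ u , v ⟩ = ∑ (λ i → u i * v i)

  _·ᵐ_ : ∀ {d} → Mat d → Mat d → Mat d
  (M ·ᵐ N) i j = ∑ (λ k → M i k * N k j)

  _·ᵛ_ : ∀ {d} → Mat d → Vecᵈ d → Vecᵈ d
  (M ·ᵛ v) i = ∑ (λ k → M i k * v k)

  _ᵀ : ∀ {d} → Mat d → Mat d
  (M ᵀ) i j = M j i

  I : ∀ {d} → Mat d
  I i j with i ≟ j
  ... | yes _ = 1#
  ... | no _  = 0#

  IsInverse : ∀ {d} → Mat d → Mat d → Set ℓ
  IsInverse M N = ((M ·ᵐ N) ≈ᵐ I) × ((N ·ᵐ M) ≈ᵐ I)

  VSet : ℕ → Set (lsuc (c ⊔ ℓ))
  VSet d = Pred (Vecᵈ d) (c ⊔ ℓ)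

  Spans : ∀ {d} → VSet d → Set (c ⊔ ℓ)
  Spans {d} S = ∀ (v : Vecᵈ d) → Σ ℕ λ n → Σ (Fin n → Carrier) λ λ' → Σ (Fin n → Vecᵈ d) λ w →
    ((∀ (i : Fin n) → S (w i)) × (v ≈ᵛ (λ j → ∑ (λ i → λ' i * w i j))))

  ZeroOrOne : Carrier → Set ℓ
  ZeroOrOne x = (x ≈ 0#) ⊎ (x ≈ 1#)

  record TwoLevelConfig (d : ℕ) : Set (lsuc (c ⊔ ℓ)) where
    field
      A B    : VSet d
      spanA  : Spans A
      spanB  : Spans B
      -- maximality (which includes ⟨a,b⟩ ∈ {0,1} for a ∈ A, b ∈ B)
      maxA   : ∀ a → A a ⇔ (∀ b → B b → ZeroOrOne ⟨ a , b ⟩)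
      maxB   : ∀ b → B b ⇔ (∀ a → A a → ZeroOrOne ⟨ a , b ⟩)

  Elems : ∀ {d} → VSet d → Setoid (c ⊔ ℓ) ℓ
  Elems {d} S = record
    { Carrier = Σ (Vecᵈ d) S
    ; _≈_ = λ x y → proj₁ x ≈ᵛ proj₁ y
    ; isEquivalence = record
      { refl = λ i → refl
      ; sym = λ p i → sym (p i)
      ; trans = λ p q i → trans (p i) (q i) } }

  -- S(A,B) and S(A',B') agree up to permuting rows and columns:
  -- bijections σ : A → A', τ : B → B' with ⟨σ a , τ b⟩ = ⟨a , b⟩
  SameSlackUpToPerm : ∀ {d} → TwoLevelConfig d → TwoLevelConfig d → Set _
  SameSlackUpToPerm C C' =
    Σ (Bijection (Elems (TwoLevelConfig.A C)) (Elems (TwoLevelConfig.A C'))) λ σ →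
    Σ (Bijection (Elems (TwoLevelConfig.B C)) (Elems (TwoLevelConfig.B C'))) λ τ →
      ∀ a b → ⟨ proj₁ (Bijection.to σ a) , proj₁ (Bijection.to τ b) ⟩ ≈ ⟨ proj₁ a , proj₁ b ⟩

  LinearlyEquivalent : ∀ {d} → TwoLevelConfig d → TwoLevelConfig d → Set _
  LinearlyEquivalent {d} C C' = ∃[ M ] ∃[ N ] (IsInverse {d} M N ×
      (∀ x → TwoLevelConfig.A C' x ⇔ (∃[ a ] (TwoLevelConfig.A C a × (x ≈ᵛ ((N ᵀ) ·ᵛ a))))) ×
      (∀ x → TwoLevelConfig.B C' x ⇔ (∃[ b ] (TwoLevelConfig.B C b × (x ≈ᵛ (M ·ᵛ b))))))

-- Spanning sets separate points: a vector is determined by its inner products with a spanning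
-- set. Fix an expression of each standard basis vector in terms of B; then the slack bijection
-- τ : B → B' extends column by column to a matrix M. For a' = σ a the slack condition gives
-- ⟨a', M y⟩ = ⟨a, y⟩ for all y, so M agrees with τ on B because A' spans. Symmetrically σ
-- extends to a matrix P agreeing with σ on A, and ⟨a, Pᵀ M y⟩ = ⟨σ a, M y⟩ = ⟨a, y⟩ gives
-- Pᵀ M = I because A spans; the same construction applied to τ⁻¹ yields a right inverse of M,
-- so Pᵀ = M⁻¹. Hence A' = σ(A) = M⁻ᵀ(A) and B' = τ(B) = M(B). Since spanning comes with
-- explicit coefficients, inverses in K are never needed.
module Submission where

open import Defs
open import Level using (Level)
open import Data.Nat using (ℕ; zero; suc)
open import Data.Fin using (Fin; zero; suc; _≟_)
open import Data.Product using (Σ; ∃-syntax; _×_; _,_; proj₁; proj₂)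
open import Data.Sum using (inj₁; inj₂)
open import Function using (_∘_)
open import Function.Bundles using (_⇔_; mk⇔; Bijection; module Equivalence)
open import Relation.Nullary using (yes; no)
open import Relation.Binary.PropositionalEquality as ≡ using (_≡_)
import Relation.Binary.Reasoning.Setoid as ≈-Reasoning
import Algebra.Properties.Semiring.Sum as SemiringSum

module LinearAlgebraProperties {c ℓ : Level} (K : Field c ℓ) where
  open Field K hiding (zero)
  open LinearAlgebra K
  open SemiringSum semiring using (sum; sum-cong-≋; sum-replicate-zero; *-distribˡ-sum)
    renaming (∑-comm to sum-comm)
  open ≈-Reasoning setoid

  ∑≡sum : ∀ {n} (f : Fin n → Carrier) → ∑ f ≡ sum f
  ∑≡sum {zero}  f = ≡.refl
  ∑≡sum {suc n} f = ≡.cong (f zero +_) (∑≡sum (f ∘ suc))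

  ∑-cong : ∀ {n} {f g : Fin n → Carrier} → (∀ i → f i ≈ g i) → ∑ f ≈ ∑ g
  ∑-cong {f = f} {g} f≈g = begin
    ∑ f   ≡⟨ ∑≡sum f ⟩
    sum f ≈⟨ sum-cong-≋ f≈g ⟩
    sum g ≡⟨ ∑≡sum g ⟨
    ∑ g   ∎

  ∑-zero : ∀ n → ∑ {n} (λ _ → 0#) ≈ 0#
  ∑-zero n = trans (reflexive (∑≡sum {n} (λ _ → 0#))) (sum-replicate-zero n)

  *-distribˡ-∑ : ∀ {n} x (f : Fin n → Carrier) → x * ∑ f ≈ ∑ (λ i → x * f i)
  *-distribˡ-∑ x f = begin
    x * ∑ f             ≡⟨ ≡.cong (x *_) (∑≡sum f) ⟩
    x * sum f           ≈⟨ *-distribˡ-sum x f ⟩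
    sum (λ i → x * f i) ≡⟨ ∑≡sum (λ i → x * f i) ⟨
    ∑ (λ i → x * f i)   ∎

  ∑-comm : ∀ {m n} (f : Fin m → Fin n → Carrier) →
           ∑ (λ i → ∑ (λ j → f i j)) ≈ ∑ (λ j → ∑ (λ i → f i j))
  ∑-comm f = begin
    ∑ (λ i → ∑ (f i))             ≈⟨ ∑-cong (λ i → reflexive (∑≡sum (f i))) ⟩
    ∑ (λ i → sum (f i))           ≡⟨ ∑≡sum (λ i → sum (f i)) ⟩
    sum (λ i → sum (f i))         ≈⟨ sum-comm f ⟩
    sum (λ j → sum (λ i → f i j)) ≡⟨ ∑≡sum (λ j → sum (λ i → f i j)) ⟨
    ∑ (λ j → sum (λ i → f i j))   ≈⟨ ∑-cong (λ j → reflexive (≡.sym (∑≡sum (λ i → f i j)))) ⟩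
    ∑ (λ j → ∑ (λ i → f i j))     ∎

  ≈ᵛ-refl : ∀ {d} {v : Vecᵈ d} → v ≈ᵛ v
  ≈ᵛ-refl _ = refl

  ≈ᵛ-sym : ∀ {d} {u v : Vecᵈ d} → u ≈ᵛ v → v ≈ᵛ u
  ≈ᵛ-sym u≈v i = sym (u≈v i)

  ⟨⟩-cong : ∀ {d} {u u′ v v′ : Vecᵈ d} → u ≈ᵛ u′ → v ≈ᵛ v′ → ⟨ u , v ⟩ ≈ ⟨ u′ , v′ ⟩
  ⟨⟩-cong u≈u′ v≈v′ = ∑-cong (λ i → *-cong (u≈u′ i) (v≈v′ i))

  ⟨⟩-congˡ : ∀ {d} {u u′ v : Vecᵈ d} → u ≈ᵛ u′ → ⟨ u , v ⟩ ≈ ⟨ u′ , v ⟩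
  ⟨⟩-congˡ u≈u′ = ⟨⟩-cong u≈u′ ≈ᵛ-refl

  ⟨⟩-congʳ : ∀ {d} {u v v′ : Vecᵈ d} → v ≈ᵛ v′ → ⟨ u , v ⟩ ≈ ⟨ u , v′ ⟩
  ⟨⟩-congʳ = ⟨⟩-cong ≈ᵛ-refl

  ⟨⟩-comm : ∀ {d} (u v : Vecᵈ d) → ⟨ u , v ⟩ ≈ ⟨ v , u ⟩
  ⟨⟩-comm u v = ∑-cong (λ i → *-comm (u i) (v i))

  combination : ∀ {d n} → (Fin n → Carrier) → (Fin n → Vecᵈ d) → Vecᵈ d
  combination α w j = ∑ (λ i → α i * w i j)

  ⟨⟩-combinationʳ : ∀ {d n} (u : Vecᵈ d) (α : Fin n → Carrier) (w : Fin n → Vecᵈ d) →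
                    ⟨ u , combination α w ⟩ ≈ ∑ (λ i → α i * ⟨ u , w i ⟩)
  ⟨⟩-combinationʳ u α w = begin
    ∑ (λ k → u k * ∑ (λ i → α i * w i k))
      ≈⟨ ∑-cong (λ k → *-distribˡ-∑ (u k) (λ i → α i * w i k)) ⟩
    ∑ (λ k → ∑ (λ i → u k * (α i * w i k)))
      ≈⟨ ∑-comm (λ k i → u k * (α i * w i k)) ⟩
    ∑ (λ i → ∑ (λ k → u k * (α i * w i k)))
      ≈⟨ ∑-cong (λ i → ∑-cong (λ k → x*[y*z]≈y*[x*z] (u k) (α i) (w i k))) ⟩
    ∑ (λ i → ∑ (λ k → α i * (u k * w i k)))
      ≈⟨ ∑-cong (λ i → sym (*-distribˡ-∑ (α i) (λ k → u k * w i k))) ⟩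
    ∑ (λ i → α i * ⟨ u , w i ⟩) ∎
    where
    x*[y*z]≈y*[x*z] : ∀ x y z → x * (y * z) ≈ y * (x * z)
    x*[y*z]≈y*[x*z] x y z =
      trans (sym (*-assoc x y z)) (trans (*-cong (*-comm x y) refl) (*-assoc y x z))

  e : ∀ {d} → Fin d → Vecᵈ d
  e j i = I i j

  I-suc : ∀ {n} (i j : Fin n) → I (suc i) (suc j) ≡ I i j
  I-suc i j with i ≟ j
  ... | yes _ = ≡.refl
  ... | no _  = ≡.refl

  ⟨⟩-eʳ : ∀ {d} (u : Vecᵈ d) (j : Fin d) → ⟨ u , e j ⟩ ≈ u j
  ⟨⟩-eʳ {suc d} u zero = begin
    u zero * 1# + ∑ (λ k → u (suc k) * 0#)
      ≈⟨ +-cong (*-identityʳ (u zero)) (∑-cong (λ k → zeroʳ (u (suc k)))) ⟩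
    u zero + ∑ {d} (λ _ → 0#) ≈⟨ +-cong refl (∑-zero d) ⟩
    u zero + 0#               ≈⟨ +-identityʳ (u zero) ⟩
    u zero                    ∎
  ⟨⟩-eʳ {suc d} u (suc j) = begin
    u zero * 0# + ∑ (λ k → u (suc k) * I (suc k) (suc j))
      ≈⟨ +-cong (zeroʳ (u zero)) (∑-cong (λ k → reflexive (≡.cong (u (suc k) *_) (I-suc k j)))) ⟩
    0# + ⟨ u ∘ suc , e j ⟩ ≈⟨ +-identityˡ _ ⟩
    ⟨ u ∘ suc , e j ⟩      ≈⟨ ⟨⟩-eʳ (u ∘ suc) j ⟩
    u (suc j)              ∎

  column : ∀ {d} → Mat d → Fin d → Vecᵈ d
  column N j k = N k j

  ·ᵛ-cong : ∀ {d} (N : Mat d) {v w : Vecᵈ d} → v ≈ᵛ w → (N ·ᵛ v) ≈ᵛ (N ·ᵛ w)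
  ·ᵛ-cong N v≈w k = ⟨⟩-congʳ v≈w

  ⟨⟩-·ᵛ-adjoint : ∀ {d} (N : Mat d) (x v : Vecᵈ d) → ⟨ x , N ·ᵛ v ⟩ ≈ ⟨ (N ᵀ) ·ᵛ x , v ⟩
  ⟨⟩-·ᵛ-adjoint N x v = begin
    ⟨ x , N ·ᵛ v ⟩
      ≈⟨ ⟨⟩-congʳ (λ k → ∑-cong (λ j → *-comm (N k j) (v j))) ⟩
    ⟨ x , combination v (column N) ⟩
      ≈⟨ ⟨⟩-combinationʳ x v (column N) ⟩
    ∑ (λ j → v j * ⟨ x , column N j ⟩)
      ≈⟨ ∑-cong (λ j → trans (*-comm (v j) _) (*-cong (⟨⟩-comm x (column N j)) refl)) ⟩
    ⟨ (N ᵀ) ·ᵛ x , v ⟩ ∎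

  ·ᵛ-inverse⇒·ᵐ-inverse : ∀ {d} (M N : Mat d) → (∀ z → (M ·ᵛ (N ·ᵛ z)) ≈ᵛ z) → (M ·ᵐ N) ≈ᵐ I
  ·ᵛ-inverse⇒·ᵐ-inverse M N MN≈id i j = begin
    ∑ (λ k → M i k * N k j) ≈⟨ ∑-cong (λ k → *-cong refl (sym (⟨⟩-eʳ (N k) j))) ⟩
    (M ·ᵛ (N ·ᵛ e j)) i     ≈⟨ MN≈id (e j) i ⟩
    I i j                   ∎

  ·ᵛ-left-inverse⇒right-inverse : ∀ {d} (M N Q : Mat d) →
    (∀ z → (N ·ᵛ (M ·ᵛ z)) ≈ᵛ z) → (∀ z → (M ·ᵛ (Q ·ᵛ z)) ≈ᵛ z) →
    ∀ z → (M ·ᵛ (N ·ᵛ z)) ≈ᵛ z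
  ·ᵛ-left-inverse⇒right-inverse M N Q NM≈id MQ≈id z i = begin
    (M ·ᵛ (N ·ᵛ z)) i               ≈⟨ ·ᵛ-cong M (·ᵛ-cong N (≈ᵛ-sym (MQ≈id z))) i ⟩
    (M ·ᵛ (N ·ᵛ (M ·ᵛ (Q ·ᵛ z)))) i ≈⟨ ·ᵛ-cong M (NM≈id (Q ·ᵛ z)) i ⟩
    (M ·ᵛ (Q ·ᵛ z)) i               ≈⟨ MQ≈id z i ⟩
    z i                             ∎

  module BasisExpansion {d} {S : VSet d} (spans : Spans S) (j : Fin d) where
    n : ℕ
    n = proj₁ (spans (e j))

    coeff : Fin n → Carrier
    coeff = proj₁ (proj₂ (spans (e j)))

    gen : Fin n → Σ (Vecᵈ d) S
    gen i = proj₁ (proj₂ (proj₂ (spans (e j)))) i , proj₁ (proj₂ (proj₂ (proj₂ (spans (e j))))) i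

    e≈combination : e j ≈ᵛ combination coeff (proj₁ ∘ gen)
    e≈combination = proj₂ (proj₂ (proj₂ (proj₂ (spans (e j)))))

    coordinate : ∀ z → z j ≈ ∑ (λ i → coeff i * ⟨ z , proj₁ (gen i) ⟩)
    coordinate z = begin
      z j                                       ≈⟨ sym (⟨⟩-eʳ z j) ⟩
      ⟨ z , e j ⟩                               ≈⟨ ⟨⟩-congʳ e≈combination ⟩
      ⟨ z , combination coeff (proj₁ ∘ gen) ⟩   ≈⟨ ⟨⟩-combinationʳ z coeff (proj₁ ∘ gen) ⟩
      ∑ (λ i → coeff i * ⟨ z , proj₁ (gen i) ⟩) ∎

  spans⇒separating : ∀ {d} {T : VSet d} → Spans T → ∀ {x y} →
                     (∀ t → T t → ⟨ t , x ⟩ ≈ ⟨ t , y ⟩) → x ≈ᵛ y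
  spans⇒separating {T = T} spans {x} {y} same j = begin
    x j                                       ≈⟨ coordinate x ⟩
    ∑ (λ i → coeff i * ⟨ x , proj₁ (gen i) ⟩) ≈⟨ ∑-cong (λ i → *-cong refl (same′ (gen i))) ⟩
    ∑ (λ i → coeff i * ⟨ y , proj₁ (gen i) ⟩) ≈⟨ coordinate y ⟨
    y j                                       ∎
    where
    open BasisExpansion {S = T} spans j
    same′ : ∀ t → ⟨ x , proj₁ t ⟩ ≈ ⟨ y , proj₁ t ⟩
    same′ (t , t∈T) = trans (⟨⟩-comm x t) (trans (same t t∈T) (⟨⟩-comm t y))

  extend : ∀ {d} {S : VSet d} → Spans S → (Σ (Vecᵈ d) S → Vecᵈ d) → Mat d
  extend {S = S} spans f k j = combination coeff (f ∘ gen) k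
    where open BasisExpansion {S = S} spans j

  extend-pairing : ∀ {d} {S : VSet d} (spans : Spans S) (f : Σ (Vecᵈ d) S → Vecᵈ d) (t a : Vecᵈ d) →
                   (∀ s → ⟨ t , f s ⟩ ≈ ⟨ a , proj₁ s ⟩) →
                   ∀ y → ⟨ t , extend spans f ·ᵛ y ⟩ ≈ ⟨ a , y ⟩
  extend-pairing {S = S} spans f t a pairs y =
    trans (⟨⟩-·ᵛ-adjoint (extend spans f) t y) (⟨⟩-congˡ Fᵀt≈a)
    where
    Fᵀt≈a : ((extend spans f ᵀ) ·ᵛ t) ≈ᵛ a
    Fᵀt≈a j = begin
      ⟨ combination coeff (f ∘ gen) , t ⟩       ≈⟨ ⟨⟩-comm _ t ⟩
      ⟨ t , combination coeff (f ∘ gen) ⟩       ≈⟨ ⟨⟩-combinationʳ t coeff (f ∘ gen) ⟩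
      ∑ (λ i → coeff i * ⟨ t , f (gen i) ⟩)     ≈⟨ ∑-cong (λ i → *-cong refl (pairs (gen i))) ⟩
      ∑ (λ i → coeff i * ⟨ a , proj₁ (gen i) ⟩) ≈⟨ coordinate a ⟨
      a j                                       ∎
      where open BasisExpansion {S = S} spans j

  extend-agrees : ∀ {d} {S T : VSet d} (spanS : Spans S) → Spans T →
                  (f : Σ (Vecᵈ d) S → Vecᵈ d) (g : Σ (Vecᵈ d) T → Vecᵈ d) →
                  (∀ t s → ⟨ proj₁ t , f s ⟩ ≈ ⟨ g t , proj₁ s ⟩) →
                  ∀ s → (extend spanS f ·ᵛ proj₁ s) ≈ᵛ f s
  extend-agrees spanS spanT f g adjoint s = spans⇒separating spanT λ t t∈T →
    trans (extend-pairing spanS f t (g (t , t∈T)) (adjoint (t , t∈T)) (proj₁ s))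
          (sym (adjoint (t , t∈T) s))

  ZeroOrOne-resp : ∀ {x y} → x ≈ y → ZeroOrOne x → ZeroOrOne y
  ZeroOrOne-resp x≈y (inj₁ x≈0) = inj₁ (trans (sym x≈y) x≈0)
  ZeroOrOne-resp x≈y (inj₂ x≈1) = inj₂ (trans (sym x≈y) x≈1)

  module _ {d} (C : TwoLevelConfig d) where
    open TwoLevelConfig C

    A-resp-≈ᵛ : ∀ {x y} → x ≈ᵛ y → A x → A y
    A-resp-≈ᵛ {x} {y} x≈y x∈A = Equivalence.from (maxA y) λ b b∈B →
      ZeroOrOne-resp (⟨⟩-congˡ x≈y) (Equivalence.to (maxA x) x∈A b b∈B)

    B-resp-≈ᵛ : ∀ {x y} → x ≈ᵛ y → B x → B y
    B-resp-≈ᵛ {x} {y} x≈y x∈B = Equivalence.from (maxB y) λ a a∈A →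
      ZeroOrOne-resp (⟨⟩-congʳ x≈y) (Equivalence.to (maxB x) x∈B a a∈A)

  image-of-agreeing : ∀ {d} {S S′ : VSet d} (σ : Bijection (Elems S) (Elems S′)) (F : Mat d) →
                      (∀ {x y} → x ≈ᵛ y → S′ x → S′ y) →
                      (∀ s → (F ·ᵛ proj₁ s) ≈ᵛ proj₁ (Bijection.to σ s)) →
                      ∀ x → S′ x ⇔ (∃[ s ] (S s × (x ≈ᵛ (F ·ᵛ s))))
  image-of-agreeing σ F S′-resp agrees x = mk⇔
    (λ x∈S′ → let s = to⁻ (x , x∈S′) in
      proj₁ s , proj₂ s ,
      λ i → trans (sym (proj₂ (strictlySurjective (x , x∈S′)) i)) (sym (agrees s i)))
    (λ { (s , s∈S , x≈Fs) →
      S′-resp (λ i → trans (sym (agrees (s , s∈S) i)) (sym (x≈Fs i))) (proj₂ (to (s , s∈S))) })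
    where open Bijection σ

  module SlackBijection {d} (C C′ : TwoLevelConfig d)
    (σ : Bijection (Elems (TwoLevelConfig.A C)) (Elems (TwoLevelConfig.A C′)))
    (τ : Bijection (Elems (TwoLevelConfig.B C)) (Elems (TwoLevelConfig.B C′)))
    (slack : ∀ a b →
      ⟨ proj₁ (Bijection.to σ a) , proj₁ (Bijection.to τ b) ⟩ ≈ ⟨ proj₁ a , proj₁ b ⟩)
    where
    private
      module C = TwoLevelConfig C
      module C′ = TwoLevelConfig C′
      module σ = Bijection σ
      module τ = Bijection τ

    σ̂ : Σ (Vecᵈ d) C.A → Vecᵈ d
    σ̂ = proj₁ ∘ σ.to

    τ̂ : Σ (Vecᵈ d) C.B → Vecᵈ d
    τ̂ = proj₁ ∘ τ.to

    τ̂⁻¹ : Σ (Vecᵈ d) C′.B → Vecᵈ d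
    τ̂⁻¹ = proj₁ ∘ τ.to⁻

    σ̂∘σ⁻¹ : ∀ a′ → σ̂ (σ.to⁻ a′) ≈ᵛ proj₁ a′
    σ̂∘σ⁻¹ a′ = proj₂ (σ.strictlySurjective a′)

    τ̂∘τ⁻¹ : ∀ b′ → τ̂ (τ.to⁻ b′) ≈ᵛ proj₁ b′
    τ̂∘τ⁻¹ b′ = proj₂ (τ.strictlySurjective b′)

    M P Q : Mat d
    M = extend C.spanB τ̂
    P = extend C.spanA σ̂
    Q = extend C′.spanB τ̂⁻¹

    M-agrees : ∀ b → (M ·ᵛ proj₁ b) ≈ᵛ τ̂ b
    M-agrees = extend-agrees C.spanB C′.spanA τ̂ (proj₁ ∘ σ.to⁻) λ a′ b →
      trans (⟨⟩-congˡ (≈ᵛ-sym (σ̂∘σ⁻¹ a′))) (slack (σ.to⁻ a′) b)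

    P-agrees : ∀ a → (P ·ᵛ proj₁ a) ≈ᵛ σ̂ a
    P-agrees = extend-agrees C.spanA C′.spanB σ̂ (proj₁ ∘ τ.to⁻) λ b′ a → begin
      ⟨ proj₁ b′ , σ̂ a ⟩     ≈⟨ ⟨⟩-comm (proj₁ b′) (σ̂ a) ⟩
      ⟨ σ̂ a , proj₁ b′ ⟩     ≈⟨ ⟨⟩-congʳ (≈ᵛ-sym (τ̂∘τ⁻¹ b′)) ⟩
      ⟨ σ̂ a , τ̂ (τ.to⁻ b′) ⟩ ≈⟨ slack a (τ.to⁻ b′) ⟩
      ⟨ proj₁ a , τ̂⁻¹ b′ ⟩   ≈⟨ ⟨⟩-comm (proj₁ a) (τ̂⁻¹ b′) ⟩
      ⟨ τ̂⁻¹ b′ , proj₁ a ⟩   ∎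

    Pᵀ-left-inverse : ∀ z → ((P ᵀ) ·ᵛ (M ·ᵛ z)) ≈ᵛ z
    Pᵀ-left-inverse z = spans⇒separating C.spanA λ a a∈A → begin
      ⟨ a , (P ᵀ) ·ᵛ (M ·ᵛ z) ⟩ ≈⟨ ⟨⟩-·ᵛ-adjoint (P ᵀ) a (M ·ᵛ z) ⟩
      ⟨ P ·ᵛ a , M ·ᵛ z ⟩       ≈⟨ ⟨⟩-congˡ (P-agrees (a , a∈A)) ⟩
      ⟨ σ̂ (a , a∈A) , M ·ᵛ z ⟩  ≈⟨ extend-pairing C.spanB τ̂ _ a (slack (a , a∈A)) z ⟩
      ⟨ a , z ⟩                 ∎

    Q-right-inverse : ∀ z → (M ·ᵛ (Q ·ᵛ z)) ≈ᵛ z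
    Q-right-inverse z = spans⇒separating C′.spanA λ a′ a′∈A′ →
      let a = σ.to⁻ (a′ , a′∈A′) in begin
      ⟨ a′ , M ·ᵛ (Q ·ᵛ z) ⟩  ≈⟨ ⟨⟩-congˡ (≈ᵛ-sym (σ̂∘σ⁻¹ (a′ , a′∈A′))) ⟩
      ⟨ σ̂ a , M ·ᵛ (Q ·ᵛ z) ⟩ ≈⟨ extend-pairing C.spanB τ̂ _ (proj₁ a) (slack a) (Q ·ᵛ z) ⟩
      ⟨ proj₁ a , Q ·ᵛ z ⟩    ≈⟨ extend-pairing C′.spanB τ̂⁻¹ _ (σ̂ a) (τ̂⁻¹-adjoint a) z ⟩
      ⟨ σ̂ a , z ⟩             ≈⟨ ⟨⟩-congˡ (σ̂∘σ⁻¹ (a′ , a′∈A′)) ⟩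
      ⟨ a′ , z ⟩              ∎
      where
      τ̂⁻¹-adjoint : ∀ a b′ → ⟨ proj₁ a , τ̂⁻¹ b′ ⟩ ≈ ⟨ σ̂ a , proj₁ b′ ⟩
      τ̂⁻¹-adjoint a b′ = trans (sym (slack a (τ.to⁻ b′))) (⟨⟩-congʳ (τ̂∘τ⁻¹ b′))

lemma2p4 : {c ℓ : Level} (K : Field c ℓ) (d : ℕ)
    (C C' : LinearAlgebra.TwoLevelConfig K d) →
    LinearAlgebra.SameSlackUpToPerm K C C' →
    LinearAlgebra.LinearlyEquivalent K C C'
lemma2p4 K d C C′ (σ , τ , slack) =
  M , P ᵀ , (M·Pᵀ≈I , Pᵀ·M≈I) ,
  image-of-agreeing σ P (A-resp-≈ᵛ C′) P-agrees ,
  image-of-agreeing τ M (B-resp-≈ᵛ C′) M-agrees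
  where
  open LinearAlgebra K
  open LinearAlgebraProperties K
  open SlackBijection C C′ σ τ slack

  M·Pᵀ≈I : (M ·ᵐ (P ᵀ)) ≈ᵐ I
  M·Pᵀ≈I = ·ᵛ-inverse⇒·ᵐ-inverse M (P ᵀ)
    (·ᵛ-left-inverse⇒right-inverse M (P ᵀ) Q Pᵀ-left-inverse Q-right-inverse)

  Pᵀ·M≈I : ((P ᵀ) ·ᵐ M) ≈ᵐ I
  Pᵀ·M≈I = ·ᵛ-inverse⇒·ᵐ-inverse (P ᵀ) M Pᵀ-left-inverse
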